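{- Let $R,c$ be positive integers and $p>3$ a prime with $cp-R=1$. Define \[F_{R,c}(x_1,\dots,x_5)=c\,x_1x_2x_3x_4x_5-R\sum_{i=1}^5\prod_{j\ne i}x_j-1.\] Then for every prime $\ell$, the equation $F_{R,c}(x_1,\dots,x_5)=0$ has a solution in $(\mathbb F_\ell^\times)^5$. -}

module Defs where

open import Data.Nat using (ℕ) renaming (_≤_ to _≤ℕ_; _<_ to _<ℕ_)
open import Data.Product using (_×_)
open import Data.Integer using (ℤ; +_; _*_; _+_; _-_)

F : ℕ → ℕ → ℤ → ℤ → ℤ → ℤ → ℤ → ℤ
F R c x₁ x₂ x₃ x₄ x₅ =
  (+ c) * (x₁ * x₂ * x₃ * x₄ * x₅)
  - (+ R) * (  x₂ * x₃ * x₄ * x₅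
             + x₁ * x₃ * x₄ * x₅
             + x₁ * x₂ * x₄ * x₅
             + x₁ * x₂ * x₃ * x₅
             + x₁ * x₂ * x₃ * x₄)
  - + 1

-- x represents a nonzero residue class mod ℓ, i.e. an element of 𝔽_ℓ^×
-- (canonical representatives 1,...,ℓ-1).
Unit : ℕ → ℕ → Set
Unit ℓ x = 1 ≤ℕ x × x <ℕ ℓ

{-# OPTIONS --safe #-}
-- On the line (x, 1, 1, 1, s) the polynomial is x·A(s) − B(s) with
-- A(s) = (c − 3R)s − R and B(s) = Rs + 1, so for a unit s with ℓ ∤ A(s) and
-- ℓ ∤ B(s) the unit x = B(s)/A(s) gives a solution.  Both affine forms have
-- coprime coefficients (p(c − 3R) + (3p − 1)R = cp − R = 1), so each has at most
-- one root modulo ℓ, and for ℓ ≥ 5 one of s = 1, 2, 3 avoids both.  For ℓ = 3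
-- the only obstruction left is A(1) ≡ B(2) ≡ 0, where (1, 1, 2, 2, 2) is a
-- solution; for ℓ = 2 the point (1, …, 1) works because p is odd.
module Submission where

open import Defs

-- Signed divisibility carries the algebraic API; the statement's _∣_ is the
-- unsigned one, so the development lives in its own scope and converts with ∣⇒∣ᵤ.
module Solvability where
  open import Data.Nat.Base using (ℕ; zero; suc; NonZero; _<_; _≤_; z≤n; s≤s)
  import Data.Nat.Base as ℕ
  open import Data.Nat.Properties using (<-trans; ≤-<-trans; n<1+n)
  import Data.Nat.Divisibility as ℕ
  open import Data.Nat.Coprimality using (Coprime; prime⇒coprime; coprime-Bézout)
  open import Data.Nat.GCD using (module Bézout)
  open import Data.Nat.Primality
    using (Prime; prime⇒nonZero; composite; composite⇒¬prime)
  open import Data.Integer.Base using (ℤ; +_; -_; _+_; _-_; _*_; 0ℤ; 1ℤ)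
  open import Data.Integer.Properties
    using (pos-*; +-identityʳ; *-identityˡ; *-zeroʳ; neg-distribˡ-*)
  open import Data.Integer.DivMod using (_%ℕ_; _/ℕ_; n%ℕd<d; a≡a%ℕn+[a/ℕn]*n)
  open import Data.Integer.Divisibility.Signed
  import Data.Integer.Divisibility as Unsigned
  open import Data.Integer.Tactic.RingSolver using (solve; solve-∀)
  open import Data.List.Base using (_∷_; [])
  open import Data.Product.Base using (Σ; ∃; _×_; _,_)
  open import Data.Sum.Base using (_⊎_; inj₁; inj₂)
  open import Data.Empty using (⊥; ⊥-elim)
  open import Relation.Nullary using (¬_; yes; no)
  open import Relation.Binary.PropositionalEquality
    using (_≡_; refl; sym; trans; cong; subst; module ≡-Reasoning)
  open ≡-Reasoning

  2∣n⊎2∣1+n : ∀ n → 2 ℕ.∣ n ⊎ 2 ℕ.∣ suc n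
  2∣n⊎2∣1+n zero = inj₁ (ℕ.divides 0 refl)
  2∣n⊎2∣1+n (suc n) with 2∣n⊎2∣1+n n
  ... | inj₁ 2∣n   = inj₂ (ℕ.∣m∣n⇒∣m+n ℕ.∣-refl 2∣n)
  ... | inj₂ 2∣1+n = inj₁ 2∣1+n

  prime-cases : ∀ {ℓ} → Prime ℓ → ℓ ≡ 2 ⊎ ℓ ≡ 3 ⊎ 3 < ℓ
  prime-cases {0} ()
  prime-cases {1} ()
  prime-cases {2} _ = inj₁ refl
  prime-cases {3} _ = inj₂ (inj₁ refl)
  prime-cases {suc (suc (suc (suc _)))} _ = inj₂ (inj₂ (s≤s (s≤s (s≤s (s≤s z≤n)))))

  >⇒∤-pos : ∀ {ℓ d} .{{_ : NonZero d}} → d < ℓ → ¬ + ℓ ∣ + d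
  >⇒∤-pos d<ℓ ℓ∣d = ℕ.>⇒∤ d<ℓ (∣⇒∣ᵤ ℓ∣d)

  i≡j+k⇒i-j≡k : ∀ {i} j k → i ≡ j + k → i - j ≡ k
  i≡j+k⇒i-j≡k j k refl = solve (j ∷ k ∷ [])

  pos-1+m*n≡o*k : ∀ m n o k → suc (m ℕ.* n) ≡ o ℕ.* k → 1ℤ + + m * + n ≡ + o * + k
  pos-1+m*n≡o*k m n o k eq =
    trans (cong (λ i → 1ℤ + i) (sym (pos-* m n))) (trans (cong +_ eq) (pos-* o k))

  affine-roots-congruent : ∀ {d α β s t} u v → u * α + v * β ≡ 1ℤ →
    d ∣ α * s + β → d ∣ α * t + β → d ∣ t - s
  affine-roots-congruent {d} {α} {β} {s} {t} u v uα+vβ≡1 d∣fs d∣ft =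
    subst (d ∣_) combination≡t-s
      (∣m∣n⇒∣m+n (∣n⇒∣m*n u (∣m∣n⇒∣m-n d∣ft d∣fs))
                 (∣n⇒∣m*n v (∣m∣n⇒∣m-n (∣n⇒∣m*n t d∣fs) (∣n⇒∣m*n s d∣ft))))
    where
    combination≡t-s :
      u * ((α * t + β) - (α * s + β)) + v * (t * (α * s + β) - s * (α * t + β)) ≡ t - s
    combination≡t-s = begin
      u * ((α * t + β) - (α * s + β)) + v * (t * (α * s + β) - s * (α * t + β))
        ≡⟨ solve (u ∷ v ∷ α ∷ β ∷ s ∷ t ∷ []) ⟩
      (u * α + v * β) * (t - s)  ≡⟨ cong (_* (t - s)) uα+vβ≡1 ⟩
      1ℤ * (t - s)               ≡⟨ *-identityˡ (t - s) ⟩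
      t - s                      ∎

  residue : ∀ ℓ .{{_ : NonZero ℓ}} A → ∃ λ a → a < ℓ × + ℓ ∣ A - + a
  residue ℓ A = A %ℕ ℓ , n%ℕd<d A ℓ ,
    divides (A /ℕ ℓ) (i≡j+k⇒i-j≡k _ _ (a≡a%ℕn+[a/ℕn]*n A ℓ))

  coprime⇒invertible : ∀ {ℓ a} → Coprime ℓ a → ∃ λ u → + ℓ ∣ u * + a - 1ℤ
  coprime⇒invertible {ℓ} {a} ℓ⊥a with coprime-Bézout ℓ⊥a
  ... | Bézout.+- x y 1+ya≡xℓ =
    - + y ,
    divides (- + x) (negate (+ x) (+ y) (+ a) (+ ℓ) (pos-1+m*n≡o*k y a x ℓ 1+ya≡xℓ))
    where
    negate : ∀ x y a ℓ → 1ℤ + y * a ≡ x * ℓ → - y * a - 1ℤ ≡ - x * ℓ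
    negate x y a ℓ 1+ya≡xℓ = begin
      - y * a - 1ℤ    ≡⟨ solve (y ∷ a ∷ []) ⟩
      - (1ℤ + y * a)  ≡⟨ cong -_ 1+ya≡xℓ ⟩
      - (x * ℓ)       ≡⟨ neg-distribˡ-* x ℓ ⟩
      - x * ℓ         ∎
  ... | Bézout.-+ x y 1+xℓ≡ya =
    + y ,
    divides (+ x) (i≡j+k⇒i-j≡k 1ℤ (+ x * + ℓ) (sym (pos-1+m*n≡o*k x ℓ y a 1+xℓ≡ya)))

  module _ {ℓ : ℕ} (ℓ-prime : Prime ℓ) where
    private instance
      ℓ-nonZero : NonZero ℓ
      ℓ-nonZero = prime⇒nonZero ℓ-prime

    invertible : ∀ {A} → ¬ + ℓ ∣ A → ∃ λ u → + ℓ ∣ u * A - 1ℤ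
    invertible {A} ℓ∤A with residue ℓ A
    ... | zero , _ , ℓ∣A-0 = ⊥-elim (ℓ∤A (subst (+ ℓ ∣_) (+-identityʳ A) ℓ∣A-0))
    ... | a@(suc _) , a<ℓ , ℓ∣A-a with coprime⇒invertible (prime⇒coprime ℓ-prime a<ℓ)
    ...   | u , ℓ∣ua-1 =
      u , subst (+ ℓ ∣_) (regroup u (+ a) A) (∣m∣n⇒∣m+n ℓ∣ua-1 (∣n⇒∣m*n u ℓ∣A-a))
      where
      regroup : ∀ u a A → u * a - 1ℤ + u * (A - a) ≡ u * A - 1ℤ
      regroup = solve-∀

    linear-congruence : ∀ {A B} → ¬ + ℓ ∣ A → ¬ + ℓ ∣ B →
      ∃ λ x → Unit ℓ x × + ℓ ∣ + x * A - B
    linear-congruence {A} {B} ℓ∤A ℓ∤B with invertible ℓ∤A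
    ... | u , ℓ∣uA-1 with residue ℓ (u * B)
    ...   | x , x<ℓ , ℓ∣uB-x = x , (positive ℓ∣xA-B , x<ℓ) , ℓ∣xA-B
      where
      regroup : ∀ u x A B → B * (u * A - 1ℤ) - A * (u * B - x) ≡ x * A - B
      regroup = solve-∀
      ℓ∣xA-B : + ℓ ∣ + x * A - B
      ℓ∣xA-B = subst (+ ℓ ∣_) (regroup u (+ x) A B)
        (∣m∣n⇒∣m-n (∣n⇒∣m*n B ℓ∣uA-1) (∣n⇒∣m*n A ℓ∣uB-x))
      negate : ∀ A B → - (+ 0 * A - B) ≡ B
      negate = solve-∀
      positive : ∀ {y} → + ℓ ∣ + y * A - B → 1 ≤ y
      positive {zero}  ℓ∣-B = ⊥-elim (ℓ∤B (subst (+ ℓ ∣_) (negate A B) (∣m⇒∣-m ℓ∣-B)))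
      positive {suc _} _    = s≤s z≤n

  module Line (C R : ℤ) where
    A : ℤ → ℤ
    A s = (C - + 3 * R) * s - R

    B : ℤ → ℤ
    B s = R * s + 1ℤ

    B-roots-congruent : ∀ {d s t} → d ∣ B s → d ∣ B t → d ∣ t - s
    B-roots-congruent = affine-roots-congruent {α = R} {β = 1ℤ} 0ℤ 1ℤ refl

    3∣A[1]⇒3∣B[2]⇒3∣F[1,1,2,2,2] :
      + 3 ∣ A 1ℤ → + 3 ∣ B (+ 2) → + 3 ∣ C * + 8 - R * + 28 - 1ℤ
    3∣A[1]⇒3∣B[2]⇒3∣F[1,1,2,2,2] 3∣A₁ 3∣B₂ = subst (+ 3 ∣_) regroup
      (∣m∣n⇒∣m-n (∣m∣n⇒∣m+n (∣n⇒∣m*n (+ 8) 3∣A₁) (∣n⇒∣m*n (+ 2) 3∣B₂)) ∣-refl)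
      where
      regroup :
        + 8 * ((C - + 3 * R) * 1ℤ - R) + + 2 * (R * + 2 + 1ℤ) - + 3 ≡ C * + 8 - R * + 28 - 1ℤ
      regroup = solve (C ∷ R ∷ [])

    module WhenCP-R≡1 {P : ℤ} (CP-R≡1 : C * P - R ≡ 1ℤ) where
      private
        relation-vanishes : ∀ X k → X + k * (C * P - R - 1ℤ) ≡ X
        relation-vanishes X k = begin
          X + k * (C * P - R - 1ℤ)  ≡⟨ cong (λ e → X + k * (e - 1ℤ)) CP-R≡1 ⟩
          X + k * 0ℤ                ≡⟨ cong (λ i → X + i) (*-zeroʳ k) ⟩
          X + 0ℤ                    ≡⟨ +-identityʳ X ⟩
          X                         ∎

      A-roots-congruent : ∀ {d s t} → d ∣ A s → d ∣ A t → d ∣ t - s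
      A-roots-congruent =
        affine-roots-congruent {α = C - + 3 * R} {β = - R} P (1ℤ - + 3 * P) (begin
        P * (C - + 3 * R) + (1ℤ - + 3 * P) * - R  ≡⟨ solve (C ∷ R ∷ P ∷ []) ⟩
        1ℤ + 1ℤ * (C * P - R - 1ℤ)                ≡⟨ relation-vanishes 1ℤ 1ℤ ⟩
        1ℤ                                        ∎)

      2∣1+P⇒2∣F[1,1,1,1,1] : + 2 ∣ 1ℤ + P → + 2 ∣ C * 1ℤ - R * + 5 - 1ℤ
      2∣1+P⇒2∣F[1,1,1,1,1] 2∣1+P = subst (+ 2 ∣_) regroup
        (∣m∣n⇒∣m-n (∣n⇒∣m*n C 2∣1+P) (∣m⇒∣m*n (+ 3 * R + 1ℤ) ∣-refl))
        where
        regroup : C * (1ℤ + P) - + 2 * (+ 3 * R + 1ℤ) ≡ C * 1ℤ - R * + 5 - 1ℤ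
        regroup = begin
          C * (1ℤ + P) - + 2 * (+ 3 * R + 1ℤ)
            ≡⟨ solve (C ∷ R ∷ P ∷ []) ⟩
          C * 1ℤ - R * + 5 - 1ℤ + 1ℤ * (C * P - R - 1ℤ)
            ≡⟨ relation-vanishes (C * 1ℤ - R * + 5 - 1ℤ) 1ℤ ⟩
          C * 1ℤ - R * + 5 - 1ℤ ∎

      -- Modulo 3, B 1 ≡ 0 means R ≡ −1, then A 2 ≡ 0 means C ≡ 1, so 1 = CP − R ≡ P + 1.
      3∣B[1]⇒3∣A[2]⇒3∣P : + 3 ∣ B 1ℤ → + 3 ∣ A (+ 2) → + 3 ∣ P
      3∣B[1]⇒3∣A[2]⇒3∣P 3∣B₁ 3∣A₂ = subst (+ 3 ∣_) regroup
        (∣m∣n⇒∣m-n (∣m∣n⇒∣m+n (∣n⇒∣m*n P 3∣A₂) (∣n⇒∣m*n (+ 7 * P - + 2) 3∣B₁))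
                   (∣m⇒∣m*n (+ 2 * P) ∣-refl))
        where
        regroup :
          P * ((C - + 3 * R) * + 2 - R) + (+ 7 * P - + 2) * (R * 1ℤ + 1ℤ) - + 3 * (+ 2 * P) ≡ P
        regroup = begin
          P * ((C - + 3 * R) * + 2 - R) + (+ 7 * P - + 2) * (R * 1ℤ + 1ℤ) - + 3 * (+ 2 * P)
            ≡⟨ solve (C ∷ R ∷ P ∷ []) ⟩
          P + + 2 * (C * P - R - 1ℤ)  ≡⟨ relation-vanishes P (+ 2) ⟩
          P                           ∎

  Solution : ℕ → ℕ → ℕ → Set
  Solution R c ℓ = Σ ℕ λ x₁ → Σ ℕ λ x₂ → Σ ℕ λ x₃ → Σ ℕ λ x₄ → Σ ℕ λ x₅ →
    Unit ℓ x₁ × Unit ℓ x₂ × Unit ℓ x₃ × Unit ℓ x₄ × Unit ℓ x₅ ×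
    + ℓ Unsigned.∣ F R c (+ x₁) (+ x₂) (+ x₃) (+ x₄) (+ x₅)

  unit : ∀ {ℓ n} → suc n < ℓ → Unit ℓ (suc n)
  unit = s≤s z≤n ,_

  F-on-line : ∀ R c x s →
    F R c x (+ 1) (+ 1) (+ 1) s ≡ x * Line.A (+ c) (+ R) s - Line.B (+ c) (+ R) s
  F-on-line R c = expansion (+ c) (+ R)
    where
    -- F unfolded at (x, 1, 1, 1, s): the ring solver does not unfold definitions.
    expansion : ∀ C R x s →
      C * (x * + 1 * + 1 * + 1 * s)
      - R * (  + 1 * + 1 * + 1 * s
             + x * + 1 * + 1 * s
             + x * + 1 * + 1 * s
             + x * + 1 * + 1 * s
             + x * + 1 * + 1 * + 1)
      - + 1
      ≡ x * ((C - + 3 * R) * s - R) - (R * s + 1ℤ)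
    expansion = solve-∀

  module Solutions (R c : ℕ) {p} (p-prime : Prime p) (3<p : 3 < p)
                   (cp≡R+1 : c ℕ.* p ≡ R ℕ.+ 1) where
    open Line (+ c) (+ R)

    cp-R≡1 : + c * + p - + R ≡ 1ℤ
    cp-R≡1 = i≡j+k⇒i-j≡k (+ R) 1ℤ (trans (sym (pos-* c p)) (cong +_ cp≡R+1))

    open WhenCP-R≡1 cp-R≡1

    Good : ℕ → ℕ → Set
    Good ℓ s = ¬ + ℓ ∣ A (+ s) × ¬ + ℓ ∣ B (+ s)

    Bad : ℕ → ℕ → Set
    Bad ℓ s = + ℓ ∣ A (+ s) ⊎ + ℓ ∣ B (+ s)

    good⊎bad : ∀ ℓ s → Good ℓ s ⊎ Bad ℓ s
    good⊎bad ℓ s with + ℓ ∣? A (+ s) | + ℓ ∣? B (+ s)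
    ... | yes ℓ∣A | _       = inj₂ (inj₁ ℓ∣A)
    ... | no _    | yes ℓ∣B = inj₂ (inj₂ ℓ∣B)
    ... | no ℓ∤A  | no ℓ∤B  = inj₁ (ℓ∤A , ℓ∤B)

    solution-from-good : ∀ {ℓ s} → Prime ℓ → Unit ℓ s → Good ℓ s → Solution R c ℓ
    solution-from-good {ℓ} {s} ℓ-prime (1≤s , s<ℓ) (ℓ∤A , ℓ∤B) =
      extend (linear-congruence ℓ-prime ℓ∤A ℓ∤B)
      where
      one : Unit ℓ 1
      one = unit (≤-<-trans 1≤s s<ℓ)
      extend : (∃ λ x → Unit ℓ x × + ℓ ∣ + x * A (+ s) - B (+ s)) → Solution R c ℓ
      extend (x , x-unit , ℓ∣xA-B) =
        x , 1 , 1 , 1 , s , x-unit , one , one , one , (1≤s , s<ℓ) ,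
        ∣⇒∣ᵤ (subst (+ ℓ ∣_) (sym (F-on-line R c (+ x) (+ s))) ℓ∣xA-B)

    module _ {ℓ} (2<ℓ : 2 < ℓ) where
      private
        ℓ∤1 : ¬ + ℓ ∣ 1ℤ
        ℓ∤1 = >⇒∤-pos (<-trans (n<1+n 1) 2<ℓ)

        ℓ∤2 : ¬ + ℓ ∣ + 2
        ℓ∤2 = >⇒∤-pos 2<ℓ

      no-three-bad : Bad ℓ 1 → Bad ℓ 2 → Bad ℓ 3 → ⊥
      no-three-bad (inj₁ ℓ∣A₁) (inj₁ ℓ∣A₂) _           = ℓ∤1 (A-roots-congruent ℓ∣A₁ ℓ∣A₂)
      no-three-bad (inj₂ ℓ∣B₁) (inj₂ ℓ∣B₂) _           = ℓ∤1 (B-roots-congruent ℓ∣B₁ ℓ∣B₂)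
      no-three-bad (inj₁ ℓ∣A₁) (inj₂ _)    (inj₁ ℓ∣A₃) = ℓ∤2 (A-roots-congruent ℓ∣A₁ ℓ∣A₃)
      no-three-bad (inj₁ _)    (inj₂ ℓ∣B₂) (inj₂ ℓ∣B₃) = ℓ∤1 (B-roots-congruent ℓ∣B₂ ℓ∣B₃)
      no-three-bad (inj₂ _)    (inj₁ ℓ∣A₂) (inj₁ ℓ∣A₃) = ℓ∤1 (A-roots-congruent ℓ∣A₂ ℓ∣A₃)
      no-three-bad (inj₂ ℓ∣B₁) (inj₁ _)    (inj₂ ℓ∣B₃) = ℓ∤2 (B-roots-congruent ℓ∣B₁ ℓ∣B₃)

    solution-beyond-3 : ∀ {ℓ} → Prime ℓ → 3 < ℓ → Solution R c ℓ
    solution-beyond-3 {ℓ} ℓ-prime 3<ℓ = choose (good⊎bad ℓ 1) (good⊎bad ℓ 2) (good⊎bad ℓ 3)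
      where
      2<ℓ : 2 < ℓ
      2<ℓ = <-trans (n<1+n 2) 3<ℓ
      1<ℓ : 1 < ℓ
      1<ℓ = <-trans (n<1+n 1) 2<ℓ
      choose : Good ℓ 1 ⊎ Bad ℓ 1 → Good ℓ 2 ⊎ Bad ℓ 2 → Good ℓ 3 ⊎ Bad ℓ 3 → Solution R c ℓ
      choose (inj₁ good₁) _            _            = solution-from-good ℓ-prime (unit 1<ℓ) good₁
      choose (inj₂ _)     (inj₁ good₂) _            = solution-from-good ℓ-prime (unit 2<ℓ) good₂
      choose (inj₂ _)     (inj₂ _)     (inj₁ good₃) = solution-from-good ℓ-prime (unit 3<ℓ) good₃
      choose (inj₂ bad₁)  (inj₂ bad₂)  (inj₂ bad₃)  = ⊥-elim (no-three-bad 2<ℓ bad₁ bad₂ bad₃)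

    solution-mod-3 : Prime 3 → Solution R c 3
    solution-mod-3 3-prime = choose (good⊎bad 3 1) (good⊎bad 3 2)
      where
      1<3 : 1 < 3
      1<3 = <-trans (n<1+n 1) (n<1+n 2)
      one : Unit 3 1
      one = unit 1<3
      two : Unit 3 2
      two = unit (n<1+n 2)
      choose : Good 3 1 ⊎ Bad 3 1 → Good 3 2 ⊎ Bad 3 2 → Solution R c 3
      choose (inj₁ good₁) _            = solution-from-good 3-prime one good₁
      choose (inj₂ _)     (inj₁ good₂) = solution-from-good 3-prime two good₂
      choose (inj₂ (inj₁ 3∣A₁)) (inj₂ (inj₁ 3∣A₂)) =
        ⊥-elim (>⇒∤-pos 1<3 (A-roots-congruent 3∣A₁ 3∣A₂))
      choose (inj₂ (inj₂ 3∣B₁)) (inj₂ (inj₂ 3∣B₂)) =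
        ⊥-elim (>⇒∤-pos 1<3 (B-roots-congruent 3∣B₁ 3∣B₂))
      choose (inj₂ (inj₁ 3∣A₁)) (inj₂ (inj₂ 3∣B₂)) =
        1 , 1 , 2 , 2 , 2 , one , one , two , two , two ,
        ∣⇒∣ᵤ (3∣A[1]⇒3∣B[2]⇒3∣F[1,1,2,2,2] 3∣A₁ 3∣B₂)
      choose (inj₂ (inj₂ 3∣B₁)) (inj₂ (inj₁ 3∣A₂)) = ⊥-elim
        (composite⇒¬prime (composite 3<p (∣⇒∣ᵤ (3∣B[1]⇒3∣A[2]⇒3∣P 3∣B₁ 3∣A₂))) p-prime)

    solution-mod-2 : Solution R c 2
    solution-mod-2 =
      1 , 1 , 1 , 1 , 1 , one , one , one , one , one ,
      ∣⇒∣ᵤ (2∣1+P⇒2∣F[1,1,1,1,1] 2∣1+p)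
      where
      one : Unit 2 1
      one = unit (n<1+n 1)
      2∣1+p : + 2 ∣ 1ℤ + + p
      2∣1+p with 2∣n⊎2∣1+n p
      ... | inj₁ 2∣p   = ⊥-elim (composite⇒¬prime (composite (<-trans (n<1+n 2) 3<p) 2∣p) p-prime)
      ... | inj₂ 2∣1+p = ∣ᵤ⇒∣ 2∣1+p

    solution-mod-prime : ∀ {ℓ} → Prime ℓ → Solution R c ℓ
    solution-mod-prime ℓ-prime with prime-cases ℓ-prime
    ... | inj₁ refl        = solution-mod-2
    ... | inj₂ (inj₁ refl) = solution-mod-3 ℓ-prime
    ... | inj₂ (inj₂ 3<ℓ)  = solution-beyond-3 ℓ-prime 3<ℓ

open Solvability using (module Solutions)

open import Data.Nat using (ℕ; _*_; _+_; _>_)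
open import Data.Nat.Primality using (Prime)
open import Data.Integer using (+_)
open import Data.Integer.Divisibility using (_∣_)
open import Data.Product using (Σ; _×_)
open import Relation.Binary.PropositionalEquality using (_≡_)

mainTheorem18 : (R c p : ℕ) → R > 0 → c > 0 → Prime p → p > 3 → c * p ≡ R + 1 →
    (ℓ : ℕ) → Prime ℓ →
    Σ ℕ λ x₁ → Σ ℕ λ x₂ → Σ ℕ λ x₃ → Σ ℕ λ x₄ → Σ ℕ λ x₅ →
    Unit ℓ x₁ × Unit ℓ x₂ × Unit ℓ x₃ × Unit ℓ x₄ × Unit ℓ x₅ ×
    (+ ℓ) ∣ F R c (+ x₁) (+ x₂) (+ x₃) (+ x₄) (+ x₅)
mainTheorem18 R c p _ _ p-prime p>3 cp≡R+1 ℓ ℓ-prime =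
  Solutions.solution-mod-prime R c p-prime p>3 cp≡R+1 ℓ-prime
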